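{- Let $G$ be a matroid on $[n]$ with no loops and no multiple points, with the natural linear order on $[n]$. For every line-closed set $X\in\bar{L}(G)$, $$\sum_{S\in\operatorname{nbb}(G),\ \operatorname{lc}(S)=X}(-1)^{|S|}=\bar{\mu}(X),$$ where $\bar\mu$ is the Möbius function of $\bar{L}(G)$, $\bar\mu(X)=\mu_{\bar L(G)}(\emptyset,X)$.
   Context: $\operatorname{cl}$ is matroid closure; $S$ is line-closed if $\operatorname{cl}(\{i,j\})\subseteq S$ for all $i,j\in S$; $\operatorname{lc}(S)$ is the intersection of all line-closed sets containing $S$; $\bar{L}(G)$ is the lattice of line-closed sets ordered by inclusion (bottom element $\emptyset$). An increasing set $S=\{i_1<\dots<i_p\}$ is nbb if $i_k=\min\operatorname{lc}(\{i_k,\dots,i_p\})$ for each $k$; $\operatorname{nbb}(G)$ is the set of nbb sets (including $\emptyset$). -}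

module Defs where

open import Data.Nat using (ℕ; zero; suc)
open import Data.Bool using (Bool) renaming (_≟_ to _≟𝔹_)
open import Data.Fin using (Fin; _≤_; _≤?_)
open import Data.Fin.Properties using (all?)
open import Data.Fin.Subset
  using (Subset; inside; outside; _∈_; _∉_; _⊆_; _⊂_; _∪_; ⁅_⁆; ⊥; ⋂; ∣_∣)
open import Data.Fin.Subset.Properties using (_∈?_; _⊆?_; _⊂?_)
open import Data.Integer using (ℤ; 0ℤ; 1ℤ; -_; _^_) renaming (-1ℤ to -1ℤ)
open import Data.List using (List; []; _∷_; map; filter; _++_)
open import Data.List using () renaming (sum to sumℕ)
open import Data.Product using (_×_; _,_)
open import Data.Vec using (Vec; []; _∷_; tabulate)
open import Data.Vec.Properties using (≡-dec)
open import Relation.Binary.PropositionalEquality using (_≡_)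
open import Relation.Nullary using (Dec; yes; no; ¬_)
open import Relation.Nullary.Decidable using (_×-dec_; _→-dec_)
import Data.Integer as ℤ

record Matroid (n : ℕ) : Set where
  field
    cl       : Subset n → Subset n
    cl-ext   : ∀ X → X ⊆ cl X
    cl-mono  : ∀ {X Y} → X ⊆ Y → cl X ⊆ cl Y
    cl-idem  : ∀ X → cl (cl X) ≡ cl X
    cl-exch  : ∀ X (x y : Fin n) →
               y ∈ cl (X ∪ ⁅ x ⁆) → y ∉ cl X → x ∈ cl (X ∪ ⁅ y ⁆)

-- no loops: cl ∅ = ∅ ; no multiple (parallel) points: cl {i} = {i}
Simple : ∀ {n} → Matroid n → Set
Simple {n} G = (cl ⊥ ≡ ⊥) × (∀ (i : Fin n) → cl ⁅ i ⁆ ≡ ⁅ i ⁆)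
  where open Matroid G

subsets : (n : ℕ) → List (Subset n)
subsets zero    = [] ∷ []
subsets (suc n) = map (inside ∷_) (subsets n) ++ map (outside ∷_) (subsets n)

sumℤ : List ℤ → ℤ
sumℤ []       = 0ℤ
sumℤ (x ∷ xs) = x ℤ.+ sumℤ xs

_≟ˢ_ : ∀ {n} (X Y : Subset n) → Dec (X ≡ Y)
_≟ˢ_ = ≡-dec _≟𝔹_

module _ {n : ℕ} (G : Matroid n) where
  open Matroid G

  LineClosed : Subset n → Set
  LineClosed S = ∀ i j → i ∈ S → j ∈ S → cl (⁅ i ⁆ ∪ ⁅ j ⁆) ⊆ S

  lineClosed? : (S : Subset n) → Dec (LineClosed S)
  lineClosed? S = all? λ i → all? λ j →
    (i ∈? S) →-dec ((j ∈? S) →-dec (cl (⁅ i ⁆ ∪ ⁅ j ⁆) ⊆? S))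

  lc : Subset n → Subset n
  lc S = ⋂ (filter (λ T → lineClosed? T ×-dec (S ⊆? T)) (subsets n))

  tailFrom : Fin n → Subset n → Subset n
  tailFrom i S = tabulate λ s → Data.Bool._∧_ (Relation.Nullary.Decidable.⌊ s ∈? S ⌋)
                                              (Relation.Nullary.Decidable.⌊ i ≤? s ⌋)

  -- S = {i_1 < … < i_p} is nbb if i_k = min lc({i_k,…,i_p}) for each k.
  -- Since i_k ∈ lc({i_k,…,i_p}), this says every element of that set is ≥ i_k.
  NBB : Subset n → Set
  NBB S = ∀ i → i ∈ S → ∀ j → j ∈ lc (tailFrom i S) → i ≤ j

  nbb? : (S : Subset n) → Dec (NBB S)
  nbb? S = all? λ i → (i ∈? S) →-dec all? λ j → (j ∈? lc (tailFrom i S)) →-dec (i ≤? j)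

  -- Möbius function μ(∅, X) of the lattice L̄(G) of line-closed sets
  -- (bottom ∅), via the recursion μ(∅,∅) = 1,
  -- μ(∅,X) = - Σ_{Y ∈ L̄(G), Y ⊊ X} μ(∅,Y); the fuel argument bounds
  -- the recursion depth (n+1 suffices since |X| ≤ n).
  μ-fuel : ℕ → Subset n → ℤ
  μ-fuel zero    X = 0ℤ
  μ-fuel (suc k) X with X ≟ˢ ⊥
  ... | yes _ = 1ℤ
  ... | no  _ = - sumℤ (map (μ-fuel k)
                   (filter (λ Y → lineClosed? Y ×-dec (Y ⊂? X)) (subsets n)))

  μ̄ : Subset n → ℤ
  μ̄ X = μ-fuel (suc n) X

  nbbSignSum : Subset n → ℤ
  nbbSignSum X = sumℤ (map (λ S → -1ℤ ^ ∣ S ∣)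
                   (filter (λ S → nbb? S ×-dec (lc S ≟ˢ X)) (subsets n)))

-- Write F(Y) for the signed count of the nbb sets S with lc S = Y. For line-closed X we have
-- lc S ⊆ X iff S ⊆ X, so summing F over the line-closed Y ⊆ X is the signed count of all nbb
-- subsets of X. If X ≠ ∅ and a = min X, toggling a is a sign-reversing involution on these sets:
-- a lies below every element of lc T for T ⊆ X, and toggling a does not change the tail of S
-- from any i > a. Hence those sums vanish for X ≠ ∅, while F(∅) = 1, which is the recursion
-- defining μ̄.
{-# OPTIONS --safe #-}
module Submission where

open import Data.Nat using (ℕ)
open import Data.Fin.Subset using (Subset)
open import Relation.Binary.PropositionalEquality using (_≡_)

open import Defs

open import Algebra.Properties.AbelianGroup using (inverseʳ-unique)
open import Algebra.Properties.CommutativeSemigroup using (interchange)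
open import Data.Bool using (true; false; not; if_then_else_) renaming (_≟_ to _≟𝔹_)
open import Data.Bool.Properties using (not-involutive; T-∧; T-≡)
open import Data.Fin using (Fin; zero; suc; _≤_; _≤?_) renaming (_≟_ to _≟ᶠ_)
open import Data.Fin.Properties using (≤-antisym; ¬∀⟶∃¬)
open import Data.Fin.Subset using (inside; outside; _∈_; _∉_; _⊆_; _⊂_; ⊥; ⋂; ∣_∣; Nonempty)
open import Data.Fin.Subset.Properties
  using (_∈?_; _⊆?_; _⊂?_; ∈⊤; x∈p∩q⁺; x∈p∩q⁻; ∉⊥; ⊥⊆; ⊆-antisym; ∣⊥∣≡0;
         ∣p∣≤n; p⊂q⇒p⊆q; p⊂q⇒∣p∣<∣q∣; ⊂-irref; nonempty?; Empty-unique)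
open import Data.Integer using (ℤ; 0ℤ; 1ℤ; -1ℤ; _+_; _*_; -_; _^_; +0; +[1+_]; -[1+_])
open import Data.Integer.Properties
  using (+-identityˡ; +-identityʳ; +-assoc; +-comm; neg-distrib-+; neg-distribʳ-*;
         neg-involutive; -1*i≡-i; +-commutativeSemigroup; +-0-abelianGroup)
open import Data.List using (List; []; _∷_; map; filter; _++_)
open import Data.List.Properties using (map-++; map-∘; map-cong)
open import Data.List.Membership.Propositional using () renaming (_∈_ to _∈ₗ_)
open import Data.List.Membership.Propositional.Properties
  using (∈-map⁺; ∈-++⁺ˡ; ∈-++⁺ʳ; ∈-filter⁺; ∈-filter⁻)
open import Data.List.Relation.Unary.All as All using (All; []; _∷_)
open import Data.List.Relation.Unary.Any using (here)
open import Data.Nat as ℕ using (_<_; z≤n; s≤s)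
open import Data.Nat.Properties using (<-≤-trans; ≤-pred)
open import Data.Product using (_×_; _,_; proj₁; proj₂; ∃; uncurry)
open import Data.Vec using ([]; _∷_; here; there; updateAt; lookup)
open import Data.Vec.Properties
  using (∷-injectiveˡ; ∷-injectiveʳ; updateAt-minimal; updateAt-updateAt-local; updateAt-id;
         lookup∘tabulate; []=⇒lookup; lookup⇒[]=)
open import Function using (_∘_; id)
open import Function.Bundles using (module Equivalence)
open import Level using (Level)
open import Relation.Binary.PropositionalEquality
  using (_≢_; refl; sym; trans; cong; cong₂; subst; module ≡-Reasoning)
open import Relation.Nullary using (Dec; yes; no; does; ¬_; contradiction)
open import Relation.Nullary.Decidable
  using (_×-dec_; _→-dec_; toWitness; fromWitness; decidable-stable)
open import Relation.Unary using (Decidable)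

open Equivalence using (to; from)

private
  variable
    ℓ ℓ′ : Level
    A B : Set ℓ
    P Q R : Set ℓ
    n : ℕ
    u v : ℤ

-- Iverson brackets and finite sums

infixr 7 ⟦_⟧_

⟦_⟧_ : Dec P → ℤ → ℤ
⟦ d ⟧ v = if does d then v else 0ℤ

⟦⟧-⇔ : (d : Dec P) (e : Dec Q) → (P → Q) → (Q → P) → ⟦ d ⟧ v ≡ ⟦ e ⟧ v
⟦⟧-⇔ (yes _) (yes _) _   _   = refl
⟦⟧-⇔ (yes p) (no ¬q) P→Q _   = contradiction (P→Q p) ¬q
⟦⟧-⇔ (no ¬p) (yes q) _   Q→P = contradiction (Q→P q) ¬p
⟦⟧-⇔ (no _)  (no _)  _   _   = refl

⟦⟧-×-dec : (d : Dec P) (e : Dec Q) → ⟦ d ⟧ ⟦ e ⟧ v ≡ ⟦ d ×-dec e ⟧ v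
⟦⟧-×-dec (yes _) _ = refl
⟦⟧-×-dec (no _)  _ = refl

⟦⟧-cong : (d : Dec P) → (P → u ≡ v) → ⟦ d ⟧ u ≡ ⟦ d ⟧ v
⟦⟧-cong (yes p) u≡v = u≡v p
⟦⟧-cong (no _)  _   = refl

⟦⟧-neg : (d : Dec P) → ⟦ d ⟧ (- v) ≡ - (⟦ d ⟧ v)
⟦⟧-neg (yes _) = refl
⟦⟧-neg (no _)  = refl

⟦⟧-split : (p : Dec P) (q : Dec Q) (r : Dec R) →
           (P → ¬ R → Q) → (Q → P) → (R → P) → (Q → ¬ R) →
           ⟦ p ⟧ v ≡ ⟦ q ⟧ v + ⟦ r ⟧ v
⟦⟧-split (yes _) (yes _) (no _)  _     _   _   _    = sym (+-identityʳ _)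
⟦⟧-split (yes _) (no _)  (yes _) _     _   _   _    = sym (+-identityˡ _)
⟦⟧-split (no _)  (no _)  (no _)  _     _   _   _    = refl
⟦⟧-split (yes p) (no ¬q) (no ¬r) P→¬R→Q _  _   _    = contradiction (P→¬R→Q p ¬r) ¬q
⟦⟧-split (_)     (yes q) (yes r) _     _   _   Q→¬R = contradiction r (Q→¬R q)
⟦⟧-split (no ¬p) (yes q) (no _)  _     Q→P _   _    = contradiction (Q→P q) ¬p
⟦⟧-split (no ¬p) (no _)  (yes r) _     _   R→P _    = contradiction (R→P r) ¬p

sum-++ : (xs ys : List ℤ) → sumℤ (xs ++ ys) ≡ sumℤ xs + sumℤ ys
sum-++ []       ys = sym (+-identityˡ (sumℤ ys))
sum-++ (x ∷ xs) ys = trans (cong (x +_) (sum-++ xs ys)) (sym (+-assoc x (sumℤ xs) (sumℤ ys)))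

sum-map-0 : (xs : List A) → sumℤ (map (λ _ → 0ℤ) xs) ≡ 0ℤ
sum-map-0 []       = refl
sum-map-0 (_ ∷ xs) = trans (+-identityˡ _) (sum-map-0 xs)

sum-map-+ : (f g : A → ℤ) (xs : List A) →
            sumℤ (map (λ x → f x + g x) xs) ≡ sumℤ (map f xs) + sumℤ (map g xs)
sum-map-+ f g []       = refl
sum-map-+ f g (x ∷ xs) =
  trans (cong (f x + g x +_) (sum-map-+ f g xs)) (interchange +-commutativeSemigroup (f x) (g x) _ _)

sum-map-neg : (f : A → ℤ) (xs : List A) → sumℤ (map (λ x → - f x) xs) ≡ - sumℤ (map f xs)
sum-map-neg f []       = refl
sum-map-neg f (x ∷ xs) = trans (cong (- f x +_) (sum-map-neg f xs)) (sym (neg-distrib-+ (f x) _))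

sum-map-swap : (h : A → B → ℤ) (xs : List A) (ys : List B) →
               sumℤ (map (λ x → sumℤ (map (h x) ys)) xs) ≡
               sumℤ (map (λ y → sumℤ (map (λ x → h x y) xs)) ys)
sum-map-swap h []       ys = sym (sum-map-0 ys)
sum-map-swap h (x ∷ xs) ys =
  trans (cong (sumℤ (map (h x) ys) +_) (sum-map-swap h xs ys))
        (sym (sum-map-+ (h x) (λ y → sumℤ (map (λ x → h x y) xs)) ys))

sum-map-filter : {P : A → Set ℓ′} (P? : Decidable P) (f : A → ℤ) (xs : List A) →
                 sumℤ (map f (filter P? xs)) ≡ sumℤ (map (λ x → ⟦ P? x ⟧ f x) xs)
sum-map-filter P? f []       = refl
sum-map-filter P? f (x ∷ xs) with does (P? x)
... | true  = cong (f x +_) (sum-map-filter P? f xs)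
... | false = trans (sum-map-filter P? f xs) (sym (+-identityˡ _))

⟦⟧-sum : (d : Dec P) (f : A → ℤ) (xs : List A) →
         ⟦ d ⟧ sumℤ (map f xs) ≡ sumℤ (map (λ x → ⟦ d ⟧ f x) xs)
⟦⟧-sum (yes _) f xs = refl
⟦⟧-sum (no _)  f xs = sym (sum-map-0 xs)

∈-subsets : (S : Subset n) → S ∈ₗ subsets n
∈-subsets []            = here refl
∈-subsets (inside ∷ S)  = ∈-++⁺ˡ (∈-map⁺ (inside ∷_) (∈-subsets S))
∈-subsets (outside ∷ S) =
  ∈-++⁺ʳ (map (inside ∷_) (subsets _)) (∈-map⁺ (outside ∷_) (∈-subsets S))

∑ : (Subset n → ℤ) → ℤ
∑ {n} f = sumℤ (map f (subsets n))

infix 5 ∑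
syntax ∑ (λ S → e) = ∑[ S ] e

∑-cong : {f g : Subset n → ℤ} → (∀ S → f S ≡ g S) → ∑ f ≡ ∑ g
∑-cong {n} f≗g = cong sumℤ (map-cong f≗g (subsets n))

∑-suc : (f : Subset (ℕ.suc n) → ℤ) →
        ∑ f ≡ (∑[ S ] f (inside ∷ S)) + (∑[ S ] f (outside ∷ S))
∑-suc {n} f = begin
  sumℤ (map f (map (inside ∷_) Ss ++ map (outside ∷_) Ss))
    ≡⟨ cong sumℤ (map-++ f (map (inside ∷_) Ss) _) ⟩
  sumℤ (map f (map (inside ∷_) Ss) ++ map f (map (outside ∷_) Ss))
    ≡⟨ sum-++ (map f (map (inside ∷_) Ss)) _ ⟩
  sumℤ (map f (map (inside ∷_) Ss)) + sumℤ (map f (map (outside ∷_) Ss))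
    ≡⟨ sym (cong₂ _+_ (cong sumℤ (map-∘ Ss)) (cong sumℤ (map-∘ Ss))) ⟩
  (∑[ S ] f (inside ∷ S)) + (∑[ S ] f (outside ∷ S)) ∎
  where
  open ≡-Reasoning
  Ss = subsets n

∑-δ : (C : Subset n) (h : Subset n → ℤ) → ∑[ S ] ⟦ S ≟ˢ C ⟧ h S ≡ h C
∑-δ []      h = +-identityʳ (h [])
∑-δ {ℕ.suc n} (x ∷ C) h = begin
  ∑[ S ] ⟦ S ≟ˢ (x ∷ C) ⟧ h S
    ≡⟨ ∑-suc (λ S → ⟦ S ≟ˢ (x ∷ C) ⟧ h S) ⟩
  (∑[ S ] ⟦ (inside ∷ S) ≟ˢ (x ∷ C) ⟧ h (inside ∷ S))
    + (∑[ S ] ⟦ (outside ∷ S) ≟ˢ (x ∷ C) ⟧ h (outside ∷ S))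
    ≡⟨ cong₂ _+_ (∑-cong λ S → ⟦∷≟∷⟧ inside S) (∑-cong λ S → ⟦∷≟∷⟧ outside S) ⟩
  (∑[ S ] ⟦ inside ≟𝔹 x ⟧ ⟦ S ≟ˢ C ⟧ h (inside ∷ S))
    + (∑[ S ] ⟦ outside ≟𝔹 x ⟧ ⟦ S ≟ˢ C ⟧ h (outside ∷ S))
    ≡⟨ pick x ⟩
  h (x ∷ C) ∎
  where
  open ≡-Reasoning
  ⟦∷≟∷⟧ : ∀ y S → ⟦ (y ∷ S) ≟ˢ (x ∷ C) ⟧ v ≡ ⟦ y ≟𝔹 x ⟧ ⟦ S ≟ˢ C ⟧ v
  ⟦∷≟∷⟧ y S = trans (⟦⟧-⇔ ((y ∷ S) ≟ˢ (x ∷ C)) (y ≟𝔹 x ×-dec S ≟ˢ C)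
                       (λ eq → ∷-injectiveˡ eq , ∷-injectiveʳ eq) (λ { (refl , refl) → refl }))
                    (sym (⟦⟧-×-dec (y ≟𝔹 x) (S ≟ˢ C)))
  pick : ∀ x → (∑[ S ] ⟦ inside ≟𝔹 x ⟧ ⟦ S ≟ˢ C ⟧ h (inside ∷ S))
             + (∑[ S ] ⟦ outside ≟𝔹 x ⟧ ⟦ S ≟ˢ C ⟧ h (outside ∷ S)) ≡ h (x ∷ C)
  pick inside  = trans (cong₂ _+_ (∑-δ C (h ∘ (inside ∷_))) (sum-map-0 (subsets n))) (+-identityʳ _)
  pick outside = trans (cong₂ _+_ (sum-map-0 (subsets n)) (∑-δ C (h ∘ (outside ∷_)))) (+-identityˡ _)

-- Toggling one element of a subset

toggle : Fin n → Subset n → Subset n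
toggle a S = updateAt S a not

toggle-involutive : (a : Fin n) (S : Subset n) → toggle a (toggle a S) ≡ S
toggle-involutive a S =
  trans (updateAt-updateAt-local a S (not-involutive (lookup S a))) (updateAt-id a S)

∈-toggle⁻ : {a x : Fin n} {S : Subset n} → x ∈ toggle a S → x ≢ a → x ∈ S
∈-toggle⁻ {a = a} {x} {S} x∈ x≢a =
  subst (x ∈_) (toggle-involutive a S) (updateAt-minimal x a (toggle a S) x≢a x∈)

toggle-⊆ : {a : Fin n} {S X : Subset n} → a ∈ X → S ⊆ X → toggle a S ⊆ X
toggle-⊆ {a = a} a∈X S⊆X {x} x∈ with x ≟ᶠ a
... | yes refl = a∈X
... | no  x≢a  = S⊆X (∈-toggle⁻ x∈ x≢a)

sign : Subset n → ℤ
sign S = -1ℤ ^ ∣ S ∣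

sign-toggle : (a : Fin n) (S : Subset n) → sign (toggle a S) ≡ - sign S
sign-toggle zero    (inside ∷ S)  = sym (trans (cong -_ (-1*i≡-i (sign S))) (neg-involutive (sign S)))
sign-toggle zero    (outside ∷ S) = -1*i≡-i (sign S)
sign-toggle (suc a) (inside ∷ S)  =
  trans (cong (-1ℤ *_) (sign-toggle a S)) (sym (neg-distribʳ-* -1ℤ (sign S)))
sign-toggle (suc a) (outside ∷ S) = sign-toggle a S

∑-toggle : (a : Fin n) (f : Subset n → ℤ) → ∑ f ≡ ∑ (f ∘ toggle a)
∑-toggle zero    f = begin
  ∑ f                                                  ≡⟨ ∑-suc f ⟩
  (∑[ S ] f (inside ∷ S)) + (∑[ S ] f (outside ∷ S))   ≡⟨ +-comm (∑[ S ] f (inside ∷ S)) _ ⟩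
  (∑[ S ] f (outside ∷ S)) + (∑[ S ] f (inside ∷ S))   ≡⟨ sym (∑-suc (f ∘ toggle zero)) ⟩
  ∑ (f ∘ toggle zero)                                  ∎
  where open ≡-Reasoning
∑-toggle (suc a) f = begin
  ∑ f                                                  ≡⟨ ∑-suc f ⟩
  (∑[ S ] f (inside ∷ S)) + (∑[ S ] f (outside ∷ S))
    ≡⟨ cong₂ _+_ (∑-toggle a (f ∘ (inside ∷_))) (∑-toggle a (f ∘ (outside ∷_))) ⟩
  (∑[ S ] f (inside ∷ toggle a S)) + (∑[ S ] f (outside ∷ toggle a S))
    ≡⟨ sym (∑-suc (f ∘ toggle (suc a))) ⟩
  ∑ (f ∘ toggle (suc a))                               ∎
  where open ≡-Reasoning

self-negating⇒0 : u ≡ - u → u ≡ 0ℤ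
self-negating⇒0 {+0}       _ = refl
self-negating⇒0 {+[1+ _ ]} ()
self-negating⇒0 { -[1+ _ ]} ()

∑-toggle-odd : (a : Fin n) {f : Subset n → ℤ} →
               (∀ S → f (toggle a S) ≡ - f S) → ∑ f ≡ 0ℤ
∑-toggle-odd {n} a {f} odd = self-negating⇒0 (begin
  ∑ f                    ≡⟨ ∑-toggle a f ⟩
  ∑ (f ∘ toggle a)       ≡⟨ ∑-cong odd ⟩
  ∑[ S ] - f S           ≡⟨ sum-map-neg f (subsets n) ⟩
  - ∑ f                  ∎)
  where open ≡-Reasoning

≢⊥⇒nonempty : {X : Subset n} → X ≢ ⊥ → Nonempty X
≢⊥⇒nonempty {X = X} X≢⊥ with nonempty? X
... | yes ne    = ne
... | no  empty = contradiction (Empty-unique empty) X≢⊥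

∃-least : {X : Subset n} → Nonempty X → ∃ λ a → a ∈ X × (∀ {j} → j ∈ X → a ≤ j)
∃-least {X = inside ∷ X}  _                  = zero , here , λ _ → z≤n
∃-least {X = outside ∷ X} (suc x , there x∈X) with ∃-least (x , x∈X)
... | a , a∈X , a≤ = suc a , there a∈X , λ { (there j∈X) → s≤s (a≤ j∈X) }

⊆∧≢⇒⊂ : {Y X : Subset n} → Y ⊆ X → Y ≢ X → Y ⊂ X
⊆∧≢⇒⊂ {n} {Y} {X} Y⊆X Y≢X = Y⊆X , x , x∈X , x∉Y
  where
  X⊈Y : ¬ (∀ x → x ∈ X → x ∈ Y)
  X⊈Y X⊆Y = Y≢X (⊆-antisym Y⊆X (X⊆Y _))
  witness = ¬∀⟶∃¬ n (λ x → x ∈ X → x ∈ Y) (λ x → x ∈? X →-dec x ∈? Y) X⊈Y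
  x = proj₁ witness
  x∈X : x ∈ X
  x∈X = decidable-stable (x ∈? X) (λ x∉X → proj₂ witness (λ x∈X → contradiction x∈X x∉X))
  x∉Y : x ∉ Y
  x∉Y x∈Y = proj₂ witness (λ _ → x∈Y)

∈-⋂⁺ : {x : Fin n} {Ts : List (Subset n)} → All (x ∈_) Ts → x ∈ ⋂ Ts
∈-⋂⁺ []           = ∈⊤
∈-⋂⁺ (x∈T ∷ x∈Ts) = x∈p∩q⁺ (x∈T , ∈-⋂⁺ x∈Ts)

∈-⋂⁻ : {x : Fin n} (Ts : List (Subset n)) → x ∈ ⋂ Ts → All (x ∈_) Ts
∈-⋂⁻ []       _    = []
∈-⋂⁻ (T ∷ Ts) x∈⋂ with x∈p∩q⁻ T (⋂ Ts) x∈⋂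
... | x∈T , x∈⋂Ts = x∈T ∷ ∈-⋂⁻ Ts x∈⋂Ts

-- Line closure, nbb sets and the Möbius function

module _ (G : Matroid n) where

  ∈-tailFrom⁻ : {i x : Fin n} {S : Subset n} → x ∈ tailFrom G i S → x ∈ S × i ≤ x
  ∈-tailFrom⁻ {i} {x} {S} x∈ =
    toWitness {a? = x ∈? S} (proj₁ both) , toWitness {a? = i ≤? x} (proj₂ both)
    where
    both = to T-∧ (from T-≡ (trans (sym (lookup∘tabulate _ x)) ([]=⇒lookup x∈)))

  ∈-tailFrom⁺ : {i x : Fin n} {S : Subset n} → x ∈ S → i ≤ x → x ∈ tailFrom G i S
  ∈-tailFrom⁺ {i} {x} {S} x∈S i≤x = lookup⇒[]= x _ (trans (lookup∘tabulate _ x)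
    (to T-≡ (from T-∧ (fromWitness {a? = x ∈? S} x∈S , fromWitness {a? = i ≤? x} i≤x))))

  closedAbove? : (S T : Subset n) → Dec (LineClosed G T × S ⊆ T)
  closedAbove? S T = lineClosed? G T ×-dec S ⊆? T

  lineClosed-⊥ : LineClosed G ⊥
  lineClosed-⊥ _ _ i∈⊥ = contradiction i∈⊥ ∉⊥

  ∈-lc⁺ : {S : Subset n} {x : Fin n} →
          (∀ {T} → LineClosed G T → S ⊆ T → x ∈ T) → x ∈ lc G S
  ∈-lc⁺ {S} x∈closed = ∈-⋂⁺ {Ts = filter (closedAbove? S) (subsets n)} (All.tabulate λ T∈ →
    uncurry x∈closed (proj₂ (∈-filter⁻ (closedAbove? S) {xs = subsets n} T∈)))

  lc-least : {S T : Subset n} → LineClosed G T → S ⊆ T → lc G S ⊆ T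
  lc-least {S} {T} lcT S⊆T x∈ = All.lookup (∈-⋂⁻ (filter (closedAbove? S) (subsets n)) x∈)
    (∈-filter⁺ (closedAbove? S) (∈-subsets T) (lcT , S⊆T))

  ⊆-lc : (S : Subset n) → S ⊆ lc G S
  ⊆-lc S x∈S = ∈-lc⁺ (λ _ S⊆T → S⊆T x∈S)

  lc-lineClosed : (S : Subset n) → LineClosed G (lc G S)
  lc-lineClosed S i j i∈ j∈ x∈ =
    ∈-lc⁺ λ lcT S⊆T → lcT i j (lc-least lcT S⊆T i∈) (lc-least lcT S⊆T j∈) x∈

  lc-mono : {S S′ : Subset n} → S ⊆ S′ → lc G S ⊆ lc G S′
  lc-mono {S′ = S′} S⊆S′ = lc-least (lc-lineClosed S′) (⊆-lc S′ ∘ S⊆S′)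

  nbb-toggle-least : {X S : Subset n} {a : Fin n} → LineClosed G X →
                     a ∈ X → (∀ {j} → j ∈ X → a ≤ j) → S ⊆ X → NBB G S → NBB G (toggle a S)
  nbb-toggle-least {X} {S} {a} lcX a∈X a-least S⊆X nbbS i i∈ j j∈lc with i ≟ᶠ a
  ... | yes refl = a-least (lc-least lcX (toggle-⊆ a∈X S⊆X ∘ proj₁ ∘ ∈-tailFrom⁻) j∈lc)
  ... | no  i≢a  = nbbS i (∈-toggle⁻ i∈ i≢a) j (lc-mono tail⊆ j∈lc)
    where
    tail⊆ : tailFrom G i (toggle a S) ⊆ tailFrom G i S
    tail⊆ {x} x∈ with ∈-tailFrom⁻ x∈
    ... | x∈T , i≤x = ∈-tailFrom⁺ (∈-toggle⁻ x∈T x≢a) i≤x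
      where
      x≢a : x ≢ a
      x≢a refl = i≢a (≤-antisym i≤x (a-least (toggle-⊆ a∈X S⊆X i∈)))

  nbbWithin? : (X S : Subset n) → Dec (NBB G S × S ⊆ X)
  nbbWithin? X S = nbb? G S ×-dec S ⊆? X

  ∑-nbbWithin-vanishes : {X : Subset n} → LineClosed G X → X ≢ ⊥ →
                         ∑[ S ] ⟦ nbbWithin? X S ⟧ sign S ≡ 0ℤ
  ∑-nbbWithin-vanishes {X} lcX X≢⊥ with ∃-least (≢⊥⇒nonempty X≢⊥)
  ... | a , a∈X , a-least = ∑-toggle-odd a odd
    where
    toggle-nbbWithin : ∀ {S} → NBB G S × S ⊆ X → NBB G (toggle a S) × toggle a S ⊆ X
    toggle-nbbWithin (nbbS , S⊆X) =
      nbb-toggle-least lcX a∈X a-least S⊆X nbbS , toggle-⊆ a∈X S⊆X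

    odd : ∀ S → ⟦ nbbWithin? X (toggle a S) ⟧ sign (toggle a S)
              ≡ - (⟦ nbbWithin? X S ⟧ sign S)
    odd S = begin
      ⟦ nbbWithin? X (toggle a S) ⟧ sign (toggle a S)
        ≡⟨ cong ⟦ nbbWithin? X (toggle a S) ⟧_ (sign-toggle a S) ⟩
      ⟦ nbbWithin? X (toggle a S) ⟧ - sign S
        ≡⟨ ⟦⟧-⇔ (nbbWithin? X (toggle a S)) (nbbWithin? X S)
             (subst (λ T → NBB G T × T ⊆ X) (toggle-involutive a S) ∘ toggle-nbbWithin)
             toggle-nbbWithin ⟩
      ⟦ nbbWithin? X S ⟧ - sign S
        ≡⟨ ⟦⟧-neg (nbbWithin? X S) ⟩
      - (⟦ nbbWithin? X S ⟧ sign S) ∎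
      where open ≡-Reasoning

  spans? : (S Y : Subset n) → Dec (NBB G S × lc G S ≡ Y)
  spans? S Y = nbb? G S ×-dec lc G S ≟ˢ Y

  nbbSignSum-as-∑ : (Y : Subset n) → nbbSignSum G Y ≡ ∑[ S ] ⟦ spans? S Y ⟧ sign S
  nbbSignSum-as-∑ Y = sum-map-filter (λ S → spans? S Y) sign (subsets n)

  nbbSignSum-⊥ : nbbSignSum G ⊥ ≡ 1ℤ
  nbbSignSum-⊥ = begin
    nbbSignSum G ⊥                  ≡⟨ nbbSignSum-as-∑ ⊥ ⟩
    ∑[ S ] ⟦ spans? S ⊥ ⟧ sign S    ≡⟨ ∑-cong (λ S → ⟦⟧-⇔ (spans? S ⊥) (S ≟ˢ ⊥) empty (only S)) ⟩
    ∑[ S ] ⟦ S ≟ˢ ⊥ {n} ⟧ sign S    ≡⟨ ∑-δ {n} ⊥ sign ⟩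
    sign {n} ⊥                      ≡⟨ cong (-1ℤ ^_) (∣⊥∣≡0 n) ⟩
    1ℤ                              ∎
    where
    open ≡-Reasoning
    empty : ∀ {S} → NBB G S × lc G S ≡ ⊥ → S ≡ ⊥
    empty {S} (_ , lcS≡⊥) = ⊆-antisym (subst (S ⊆_) lcS≡⊥ (⊆-lc S)) ⊥⊆
    only : ∀ S → S ≡ ⊥ → NBB G S × lc G S ≡ ⊥
    only S refl = (λ _ i∈⊥ → contradiction i∈⊥ ∉⊥) , ⊆-antisym (lc-least lineClosed-⊥ id) ⊥⊆

  closedBelow? : (X Y : Subset n) → Dec (LineClosed G Y × Y ⊆ X)
  closedBelow? X Y = lineClosed? G Y ×-dec Y ⊆? X

  ∑-closedBelow-nbbSignSum : {X : Subset n} → LineClosed G X →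
    ∑[ Y ] ⟦ closedBelow? X Y ⟧ nbbSignSum G Y ≡ ∑[ S ] ⟦ nbbWithin? X S ⟧ sign S
  ∑-closedBelow-nbbSignSum {X} lcX = begin
    ∑[ Y ] ⟦ closedBelow? X Y ⟧ nbbSignSum G Y
      ≡⟨ ∑-cong (λ Y → cong ⟦ closedBelow? X Y ⟧_ (nbbSignSum-as-∑ Y)) ⟩
    ∑[ Y ] ⟦ closedBelow? X Y ⟧ (∑[ S ] ⟦ spans? S Y ⟧ sign S)
      ≡⟨ ∑-cong (λ Y → ⟦⟧-sum (closedBelow? X Y) (λ S → ⟦ spans? S Y ⟧ sign S) (subsets n)) ⟩
    ∑[ Y ] ∑[ S ] ⟦ closedBelow? X Y ⟧ ⟦ spans? S Y ⟧ sign S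
      ≡⟨ sum-map-swap (λ Y S → ⟦ closedBelow? X Y ⟧ ⟦ spans? S Y ⟧ sign S)
                      (subsets n) (subsets n) ⟩
    ∑[ S ] ∑[ Y ] ⟦ closedBelow? X Y ⟧ ⟦ spans? S Y ⟧ sign S
      ≡⟨ ∑-cong (λ S → ∑-cong (λ Y → regroup S Y)) ⟩
    ∑[ S ] ∑[ Y ] ⟦ Y ≟ˢ lc G S ⟧ ⟦ nbbWithin? X S ⟧ sign S
      ≡⟨ ∑-cong (λ S → ∑-δ (lc G S) (λ _ → ⟦ nbbWithin? X S ⟧ sign S)) ⟩
    ∑[ S ] ⟦ nbbWithin? X S ⟧ sign S ∎
    where
    open ≡-Reasoning
    regroup : ∀ S Y → ⟦ closedBelow? X Y ⟧ ⟦ spans? S Y ⟧ sign S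
                    ≡ ⟦ Y ≟ˢ lc G S ⟧ ⟦ nbbWithin? X S ⟧ sign S
    regroup S Y = begin
      ⟦ closedBelow? X Y ⟧ ⟦ spans? S Y ⟧ sign S
        ≡⟨ ⟦⟧-×-dec (closedBelow? X Y) (spans? S Y) ⟩
      ⟦ closedBelow? X Y ×-dec spans? S Y ⟧ sign S
        ≡⟨ ⟦⟧-⇔ (closedBelow? X Y ×-dec spans? S Y) (Y ≟ˢ lc G S ×-dec nbbWithin? X S)
             (λ { ((_ , lcS⊆X) , (nbbS , refl)) → refl , nbbS , lcS⊆X ∘ ⊆-lc S })
             (λ { (refl , nbbS , S⊆X) → (lc-lineClosed S , lc-least lcX S⊆X) , nbbS , refl }) ⟩
      ⟦ Y ≟ˢ lc G S ×-dec nbbWithin? X S ⟧ sign S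
        ≡⟨ sym (⟦⟧-×-dec (Y ≟ˢ lc G S) (nbbWithin? X S)) ⟩
      ⟦ Y ≟ˢ lc G S ⟧ ⟦ nbbWithin? X S ⟧ sign S ∎

  strictlyBelow? : (X Y : Subset n) → Dec (LineClosed G Y × Y ⊂ X)
  strictlyBelow? X Y = lineClosed? G Y ×-dec Y ⊂? X

  ∑-closedBelow-split : {X : Subset n} → LineClosed G X → (f : Subset n → ℤ) →
    ∑[ Y ] ⟦ closedBelow? X Y ⟧ f Y ≡ (∑[ Y ] ⟦ strictlyBelow? X Y ⟧ f Y) + f X
  ∑-closedBelow-split {X} lcX f = begin
    ∑[ Y ] ⟦ closedBelow? X Y ⟧ f Y
      ≡⟨ ∑-cong (λ Y → ⟦⟧-split (closedBelow? X Y) (strictlyBelow? X Y) (Y ≟ˢ X)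
           (λ (lcY , Y⊆X) Y≢X → lcY , ⊆∧≢⇒⊂ Y⊆X Y≢X)
           (λ (lcY , Y⊂X) → lcY , p⊂q⇒p⊆q Y⊂X)
           (λ { refl → lcX , id })
           (λ (_ , Y⊂X) Y≡X → ⊂-irref Y≡X Y⊂X)) ⟩
    ∑[ Y ] (⟦ strictlyBelow? X Y ⟧ f Y + ⟦ Y ≟ˢ X ⟧ f Y)
      ≡⟨ sum-map-+ (λ Y → ⟦ strictlyBelow? X Y ⟧ f Y) (λ Y → ⟦ Y ≟ˢ X ⟧ f Y) (subsets n) ⟩
    (∑[ Y ] ⟦ strictlyBelow? X Y ⟧ f Y) + (∑[ Y ] ⟦ Y ≟ˢ X ⟧ f Y)
      ≡⟨ cong ((∑[ Y ] ⟦ strictlyBelow? X Y ⟧ f Y) +_) (∑-δ X f) ⟩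
    (∑[ Y ] ⟦ strictlyBelow? X Y ⟧ f Y) + f X ∎
    where open ≡-Reasoning

  μ̄-unique : (f : Subset n → ℤ) → f ⊥ ≡ 1ℤ →
    (∀ {X} → LineClosed G X → X ≢ ⊥ → ∑[ Y ] ⟦ closedBelow? X Y ⟧ f Y ≡ 0ℤ) →
    ∀ {X} → LineClosed G X → μ̄ G X ≡ f X
  μ̄-unique f f⊥≡1 f-sums-to-0 {X} lcX = μ-fuel-unique (ℕ.suc n) lcX (s≤s (∣p∣≤n X))
    where
    μ-fuel-unique : ∀ k {X} → LineClosed G X → ∣ X ∣ < k → μ-fuel G k X ≡ f X
    μ-fuel-unique (ℕ.suc k) {X} lcX ∣X∣<k with X ≟ˢ ⊥
    ... | yes refl = sym f⊥≡1
    ... | no  X≢⊥  = begin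
      - sumℤ (map (μ-fuel G k) (filter (strictlyBelow? X) (subsets n)))
        ≡⟨ cong -_ (sum-map-filter (strictlyBelow? X) (μ-fuel G k) (subsets n)) ⟩
      - (∑[ Y ] ⟦ strictlyBelow? X Y ⟧ μ-fuel G k Y)
        ≡⟨ cong -_ (∑-cong λ Y → ⟦⟧-cong (strictlyBelow? X Y) λ (lcY , Y⊂X) →
             μ-fuel-unique k lcY (<-≤-trans (p⊂q⇒∣p∣<∣q∣ Y⊂X) (≤-pred ∣X∣<k))) ⟩
      - (∑[ Y ] ⟦ strictlyBelow? X Y ⟧ f Y)
        ≡⟨ sym (inverseʳ-unique +-0-abelianGroup _ (f X)
             (trans (sym (∑-closedBelow-split lcX f)) (f-sums-to-0 lcX X≢⊥))) ⟩
      f X ∎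
      where open ≡-Reasoning

corollary2p29 : (n : ℕ) (G : Matroid n) → Simple G →
    (X : Subset n) → LineClosed G X → nbbSignSum G X ≡ μ̄ G X
corollary2p29 n G _ X lcX = sym (μ̄-unique G (nbbSignSum G) (nbbSignSum-⊥ G) sums-vanish lcX)
  where
  sums-vanish : ∀ {X} → LineClosed G X → X ≢ ⊥ →
                ∑[ Y ] ⟦ closedBelow? G X Y ⟧ nbbSignSum G Y ≡ 0ℤ
  sums-vanish lcX X≢⊥ =
    trans (∑-closedBelow-nbbSignSum G lcX) (∑-nbbWithin-vanishes G lcX X≢⊥)
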